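{- Let $\mathcal{T}$ be a first-order theory with domain $\mathbb{D}$ whose $\exists^*\forall^*$-fragment is decidable, and let $\varphi_{\mathcal{T}}(\overline{x},\overline{y})$ be an $\mathrm{LTL}_{\mathcal{T}}$ specification with literals $l_1,\dots,l_n$, environment variables $\overline{x}$ and system variables $\overline{y}$. Let $\varphi_{\mathbb{B}}$ be its Boolean abstraction, let $C_{\mathbb{B}}=\langle Q,q_0,\delta,o\rangle$ be a winning controller for $\varphi_{\mathbb{B}}$, and let $S_{\mathcal{T}}$ be the shield built from $C_{\mathbb{B}}$ as follows. At each step, given the environment input $v_{\overline{x}}$ and the output $v_{\overline{y}}$ proposed by an external controller $D$: the partitioner computes the unique valid reaction $r$ with $f_r(v_{\overline{x}})$ true and the corresponding Boolean input $v_{\overline{e}}$ ($e_r$ true, all other $e$ false); $C_{\mathbb{B}}$ in its current state $q$ outputs $o(q,v_{\overline{e}})$, with associated choice $c$, and moves to $\delta(q,v_{\overline{e}})$; if $f_r(v_{\overline{x}})\rightarrow f_c(v_{\overline{x}},v_{\overline{y}})$ is true in $\mathcal{T}$ then $S_{\mathcal{T}}$ outputs $v_{\overline{y}}$, and otherwise it outputs some $v_{\overline{y}}'$ making $f_r(v_{\overline{x}})\rightarrow f_c(v_{\overline{x}},v_{\overline{y}}')$ true. Then for every external controller $D$ (producing values in $\mathbb{D}$), the composition $D\cdot S_{\mathcal{T}}$ is a controller for $\varphi_{\mathcal{T}}$: every trace produced by $D\cdot S_{\mathcal{T}}$ (environment inputs paired with the outputs of $S_{\mathcal{T}}$) satisfies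 $\varphi_{\mathcal{T}}$.
   Context: $\mathrm{LTL}_{\mathcal{T}}$ is LTL (operators $\neg,\vee,\bigcirc,\mathcal{U}$ and derived ones) where atomic propositions are replaced by literals of $\mathcal{T}$. A trace is an infinite sequence of valuations of $\overline{x}\cup\overline{y}$ in $\mathbb{D}$; each valuation determines truth values of the literals, and the formula is evaluated with the usual LTL semantics. In the synthesis game, at each step the environment chooses a valuation of $\overline{x}$ and the system responds with a valuation of $\overline{y}$. A Boolean controller for an LTL formula over environment propositions $\overline{e}$ and system propositions $\overline{s}$ is $\langle Q,q_0,\delta,o\rangle$ with $Q$ finite, $\delta:Q\times \mathrm{val}(\overline{e})\to Q$, $o:Q\times\mathrm{val}(\overline{e})\to\mathrm{val}(\overline{s})$; it is winning if all plays according to it satisfy the formula. Boolean abstraction: introduce fresh system propositions $s_1,\dots,s_n$, $s_i$ standing for $l_i$. A choice is a set $c\subseteq\{s_1,\dots,s_n\}$, identified with the valuation of $\overline{s}$ making exactly the $s_i\in c$ true; its characteristic formula is $f_c(\overline{x},\overline{y})=\bigwedge_{s_i\in c}l_i\wedge\bigwedge_{s_i\notin c}\neg l_i$. A reaction is a set $r$ of choices, with characteristic formula $f_r(\overline{x})=\bigwedge_{c\in r}\exists\overline{y}.f_c\wedge\bigwedge_{c\notin r}\forall\overline{y}.\neg f_c$; $r$ is valid if $\exists\overline{x}.f_r(\overline{x})$ is true in $\mathcal{T}$, and $\mathit{VR}$ is the set of valid reactions. Every valuation of $\overline{x}$ satisfies $f_r$ for exactly one $r\in\mathit{VR}$. For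 each $r\in\mathit{VR}$ introduce a fresh environment proposition $e_r$; $\varphi^{legal}$ says exactly one $e_r$ is true, and $\varphi^{extra}=\bigwedge_{r}(e_r\rightarrow\bigvee_{c\in r}(\bigwedge_{s_i\in c}s_i\wedge\bigwedge_{s_i\notin c}\neg s_i))$. The Boolean abstraction is $\varphi_{\mathbb{B}}=\varphi_{\mathcal{T}}[l_i\leftarrow s_i]\wedge\square(\varphi^{legal}\rightarrow\varphi^{extra})$, an LTL formula that is equi-realizable with $\varphi_{\mathcal{T}}$. -}

module Defs where

open import Data.Nat using (ℕ; zero; suc; _≤_; _<_)
open import Data.Fin using (Fin)
open import Data.Fin.Subset using (Subset; _∈_; _∉_)
open import Data.Bool using (Bool; true; false)
open import Data.List using (List; map; upTo)
open import Data.Product using (Σ; ∃; _×_; proj₁)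
open import Data.Sum using (_⊎_)
open import Relation.Nullary using (¬_; Dec)
open import Relation.Binary.PropositionalEquality using (_≡_; _≗_)

data LTL (A : Set) : Set where
  atom : A → LTL A
  ¬ₗ_  : LTL A → LTL A
  _∨ₗ_ : LTL A → LTL A → LTL A
  _∧ₗ_ : LTL A → LTL A → LTL A
  ○_   : LTL A → LTL A
  _𝓤_  : LTL A → LTL A → LTL A
  □_   : LTL A → LTL A
  ◇_   : LTL A → LTL A

Sat : {A : Set} → (ℕ → A → Set) → LTL A → ℕ → Set
Sat σ (atom a)  i = σ i a
Sat σ (¬ₗ φ)    i = ¬ Sat σ φ i
Sat σ (φ ∨ₗ ψ)  i = Sat σ φ i ⊎ Sat σ ψ i
Sat σ (φ ∧ₗ ψ)  i = Sat σ φ i × Sat σ ψ i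
Sat σ (○ φ)     i = Sat σ φ (suc i)
Sat σ (φ 𝓤 ψ)   i = Σ ℕ λ k → i ≤ k × Sat σ ψ k × (∀ j → i ≤ j → j < k → Sat σ φ j)
Sat σ (□ φ)     i = ∀ j → i ≤ j → Sat σ φ j
Sat σ (◇ φ)     i = Σ ℕ λ j → i ≤ j × Sat σ φ j

-- The theory T is given semantically: domain 𝔻, m environment variables
-- x̄, k system variables ȳ, and n literals l₁ … lₙ, each interpreted as
-- a predicate on valuations of x̄ ∪ ȳ.  An LTL_T formula with literals
-- l₁ … lₙ is an element of LTL (Fin n) (atom i stands for lᵢ).

module Setup {𝔻 : Set} {m k n : ℕ}
             (L : Fin n → (Fin m → 𝔻) → (Fin k → 𝔻) → Set) where

  ValX : Set
  ValX = Fin m → 𝔻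

  ValY : Set
  ValY = Fin k → 𝔻

  -- A choice c ⊆ {s₁,…,sₙ} (= a valuation of s̄).
  Choice : Set
  Choice = Subset n

  fc : Choice → ValX → ValY → Set
  fc c x y = ∀ i → (i ∈ c → L i x y) × (i ∉ c → ¬ L i x y)

  Reaction : Set
  Reaction = Choice → Bool

  fr : Reaction → ValX → Set
  fr r x = ∀ c → (r c ≡ true → ∃ λ y → fc c x y)
               × (r c ≡ false → ∀ y → ¬ fc c x y)

  Valid : Reaction → Set
  Valid r = ∃ λ x → fr r x

  -- VR : the valid reactions; one environment proposition e_r per r ∈ VR.
  VR : Set
  VR = Σ Reaction Valid

  ValE : Set
  ValE = VR → Bool

  -- Decidability of the (∃*∀*) queries used by the construction
  -- (literal evaluation and ∃ȳ.f_c(v_x̄,ȳ)).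
  DecidableFragment : Set
  DecidableFragment = (∀ i x y → Dec (L i x y))
                    × (∀ c x → Dec (∃ λ y → fc c x y))

  record BController : Set where
    field
      size : ℕ
      q₀   : Fin size
      δ    : Fin size → ValE → Fin size
      o    : Fin size → ValE → Choice

  module _ (C : BController) where
    open BController C

    state : (ℕ → ValE) → ℕ → Fin size
    state es zero    = q₀
    state es (suc t) = δ (state es t) (es t)

    output : (ℕ → ValE) → ℕ → Choice
    output es t = o (state es t) (es t)

  -- φ^legal : exactly one e_r is true (reactions compared as sets)
  Legal : ValE → Set
  Legal ev = Σ VR λ r → ev r ≡ true × (∀ r′ → ev r′ ≡ true → proj₁ r′ ≗ proj₁ r)

  -- φ^extra : e_r → ⋁_{c ∈ r} (s̄ = c), i.e. the current choice lies in r
  Extra : ValE → Choice → Set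
  Extra ev s = ∀ r → ev r ≡ true → proj₁ r s ≡ true

  -- Satisfaction of φ_𝔹 = φ_T[lᵢ ← sᵢ] ∧ □(φ^legal → φ^extra) by the play
  -- of C against the environment Boolean inputs es.
  SatB : (C : BController) → LTL (Fin n) → (ℕ → ValE) → Set
  SatB C φ es = Sat (λ t i → i ∈ output C es t) φ 0
              × (∀ j → Legal (es j) → Extra (es j) (output C es j))

  Winning : BController → LTL (Fin n) → Set
  Winning C φ = ∀ es → SatB C φ es

  TTrace : (ℕ → ValX) → (ℕ → ValY) → ℕ → Fin n → Set
  TTrace xs ys t i = L i (xs t) (ys t)

  ExtController : Set
  ExtController = List ValX → ValY

  prefix : (ℕ → ValX) → ℕ → List ValX
  prefix xs t = map xs (upTo (suc t))

  Rule : Reaction → Choice → ValX → ValY → Set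
  Rule r c x y = fr r x → fc c x y

  -- (xs , ys) is a trace produced by D · S_T (S_T built from C):
  -- react t is the partitioner's reaction, ev t the Boolean input.
  record Produced (C : BController) (D : ExtController)
                  (xs : ℕ → ValX) (ys : ℕ → ValY) : Set where
    field
      react   : ℕ → VR
      reactOK : ∀ t → fr (proj₁ (react t)) (xs t)
      ev      : ℕ → ValE
      evTrue  : ∀ t r → ev t r ≡ true → proj₁ r ≗ proj₁ (react t)
      evFalse : ∀ t r → proj₁ r ≗ proj₁ (react t) → ev t r ≡ true
      outOK   : ∀ t →
        let r = proj₁ (react t)
            c = output C ev t
            d = D (prefix xs t)
        in (Rule r c (xs t) d × ys t ≡ d)
           ⊎ (¬ Rule r c (xs t) d × Rule r c (xs t) (ys t))

-- The shield never lets the Boolean controller's choice and the actual output disagree: at each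
-- step the output y realises the choice c, i.e. f_c(x, y) holds, so the literal lᵢ is true on the
-- concrete trace exactly when sᵢ is true on the Boolean play, and the concrete trace satisfies
-- φ_T because the Boolean play satisfies φ_T[lᵢ ← sᵢ]. Such a y always exists: the input x is
-- partitioned into its reaction r, the Boolean input is legal, so by φ^extra the choice c lies
-- in r, which by definition of f_r means ∃y. f_c(x, y).
module Submission where

open import Defs
open import Data.Nat using (ℕ; suc)
open import Data.Fin using (Fin)
open import Data.Fin.Subset using (Subset; _∈_)
open import Data.Fin.Subset.Properties using (_∈?_; anySubset?)
open import Data.Fin.Properties using (all?)
open import Data.Bool using (true; false)
open import Data.Bool.Properties using () renaming (_≟_ to _≟ᵇ_)
open import Data.Product using (Σ; ∃; _×_; _,_; proj₁; proj₂)
open import Data.Sum using (_⊎_; inj₁; inj₂)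
open import Function using (_∘_; _⇔_; mk⇔; Equivalence)
open import Function.Construct.Symmetry using (⇔-sym)
open import Relation.Nullary using (¬_; Dec; yes; no; does; ¬?)
open import Relation.Nullary.Decidable
  using (_×-dec_; _→-dec_; dec-true; decidable-stable)
open import Relation.Binary.PropositionalEquality using (_≡_; refl; sym; trans; _≗_)

open Equivalence using (to)

Sat-cong : ∀ {A : Set} {σ τ : ℕ → A → Set} → (∀ t a → σ t a ⇔ τ t a) →
           ∀ φ i → Sat σ φ i → Sat τ φ i
Sat-cong σ⇔τ (atom a)  i s                 = to (σ⇔τ i a) s
Sat-cong σ⇔τ (¬ₗ φ)    i ¬s                = ¬s ∘ Sat-cong (λ t a → ⇔-sym (σ⇔τ t a)) φ i
Sat-cong σ⇔τ (φ ∨ₗ ψ)  i (inj₁ s)          = inj₁ (Sat-cong σ⇔τ φ i s)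
Sat-cong σ⇔τ (φ ∨ₗ ψ)  i (inj₂ s)          = inj₂ (Sat-cong σ⇔τ ψ i s)
Sat-cong σ⇔τ (φ ∧ₗ ψ)  i (s , s′)          = Sat-cong σ⇔τ φ i s , Sat-cong σ⇔τ ψ i s′
Sat-cong σ⇔τ (○ φ)     i s                 = Sat-cong σ⇔τ φ (suc i) s
Sat-cong σ⇔τ (φ 𝓤 ψ)   i (k , i≤k , s , u) =
  k , i≤k , Sat-cong σ⇔τ ψ k s , λ j i≤j j<k → Sat-cong σ⇔τ φ j (u j i≤j j<k)
Sat-cong σ⇔τ (□ φ)     i s                 = λ j i≤j → Sat-cong σ⇔τ φ j (s j i≤j)
Sat-cong σ⇔τ (◇ φ)     i (j , i≤j , s)     = j , i≤j , Sat-cong σ⇔τ φ j s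

does≡true⇒ : ∀ {A : Set} (a? : Dec A) → does a? ≡ true → A
does≡true⇒ (yes a) _ = a

does≡false⇒¬ : ∀ {A : Set} (a? : Dec A) → does a? ≡ false → ¬ A
does≡false⇒¬ a? eq a with () ← trans (sym eq) (dec-true a? a)

∀-Subset? : ∀ {n} {P : Subset n → Set} → (∀ c → Dec (P c)) → Dec (∀ c → P c)
∀-Subset? P? with anySubset? (¬? ∘ P?)
... | yes (c , ¬Pc) = no λ ∀P → ¬Pc (∀P c)
... | no ¬∃¬P       = yes λ c → decidable-stable (P? c) (λ ¬Pc → ¬∃¬P (c , ¬Pc))

module Abstraction {𝔻 : Set} {m k n : ℕ}
                   (L : Fin n → (Fin m → 𝔻) → (Fin k → 𝔻) → Set) where
  open Setup L

  fc⇒∈⇔L : ∀ {c x y} → fc c x y → ∀ i → i ∈ c ⇔ L i x y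
  fc⇒∈⇔L {c} f i = mk⇔ (proj₁ (f i)) λ l → decidable-stable (i ∈? c) (λ i∉c → proj₂ (f i) i∉c l)

  Sat-realised : ∀ {cs : ℕ → Choice} {xs ys} → (∀ t → fc (cs t) (xs t) (ys t)) →
                 ∀ φ i → Sat (λ t i → i ∈ cs t) φ i → Sat (TTrace xs ys) φ i
  Sat-realised realised = Sat-cong λ t → fc⇒∈⇔L (realised t)

  Shielded : Reaction → Choice → ValX → ValY → ValY → Set
  Shielded r c x d y = (Rule r c x d × y ≡ d) ⊎ (¬ Rule r c x d × Rule r c x y)

  Shielded⇒fc : ∀ {r c x d y} → fr r x → Shielded r c x d y → fc c x y
  Shielded⇒fc frx (inj₁ (rule , refl)) = rule frx
  Shielded⇒fc frx (inj₂ (_ , rule))    = rule frx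

  produced⇒realised : ∀ {C D xs ys} (P : Produced C D xs ys) →
                      ∀ t → fc (output C (Produced.ev P) t) (xs t) (ys t)
  produced⇒realised P t = Shielded⇒fc (reactOK t) (outOK t)
    where open Produced P

  module Partition (L? : ∀ i x y → Dec (L i x y))
                   (∃fc? : ∀ c x → Dec (∃ λ y → fc c x y)) where

    fc? : ∀ c x y → Dec (fc c x y)
    fc? c x y = all? λ i → (i ∈? c →-dec L? i x y) ×-dec (¬? (i ∈? c) →-dec ¬? (L? i x y))

    reactionOf : ValX → Reaction
    reactionOf x c = does (∃fc? c x)

    fr-reactionOf : ∀ x → fr (reactionOf x) x
    fr-reactionOf x c =
      does≡true⇒ (∃fc? c x) , λ c∉r y f → does≡false⇒¬ (∃fc? c x) c∉r (y , f)

    validReactionOf : ValX → VR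
    validReactionOf x = reactionOf x , x , fr-reactionOf x

    _≗?_ : (r r′ : Reaction) → Dec (r ≗ r′)
    r ≗? r′ = ∀-Subset? λ c → r c ≟ᵇ r′ c

    inputOf : ValX → ValE
    inputOf x r = does (proj₁ r ≗? reactionOf x)

    inputOf-own : ∀ x → inputOf x (validReactionOf x) ≡ true
    inputOf-own x = dec-true (reactionOf x ≗? reactionOf x) (λ _ → refl)

    legal-inputOf : ∀ x → Legal (inputOf x)
    legal-inputOf x = validReactionOf x , inputOf-own x , λ r → does≡true⇒ (proj₁ r ≗? reactionOf x)

    shield : ∀ c x d → reactionOf x c ≡ true → Σ ValY (Shielded (reactionOf x) c x d)
    shield c x d c∈r with fc? c x d
    ... | yes fcd = d , inj₁ ((λ _ → fcd) , refl)
    ... | no ¬fcd = proj₁ ∃y , inj₂ ((λ rule → ¬fcd (rule (fr-reactionOf x))) , λ _ → proj₂ ∃y)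
      where
      ∃y : ∃ λ y → fc c x y
      ∃y = does≡true⇒ (∃fc? c x) c∈r

    module Composition (C : BController) (D : ExtController)
                       (extra : ∀ es j → Legal (es j) → Extra (es j) (output C es j))
                       (xs : ℕ → ValX) where

      inputs : ℕ → ValE
      inputs = inputOf ∘ xs

      choice∈reaction : ∀ t → reactionOf (xs t) (output C inputs t) ≡ true
      choice∈reaction t =
        extra inputs t (legal-inputOf (xs t)) (validReactionOf (xs t)) (inputOf-own (xs t))

      shielded : ∀ t → Σ ValY (Shielded (reactionOf (xs t)) (output C inputs t) (xs t) (D (prefix xs t)))
      shielded t = shield (output C inputs t) (xs t) (D (prefix xs t)) (choice∈reaction t)

      produced : Produced C D xs (proj₁ ∘ shielded)
      produced = record
        { react   = validReactionOf ∘ xs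
        ; reactOK = fr-reactionOf ∘ xs
        ; ev      = inputs
        ; evTrue  = λ t r → does≡true⇒ (proj₁ r ≗? reactionOf (xs t))
        ; evFalse = λ t r → dec-true (proj₁ r ≗? reactionOf (xs t))
        ; outOK   = proj₂ ∘ shielded
        }

theorem1 : {𝔻 : Set} {m k n : ℕ}
    (L : Fin n → (Fin m → 𝔻) → (Fin k → 𝔻) → Set) →
    Setup.DecidableFragment L →
    (φ : LTL (Fin n)) (C : Setup.BController L) →
    Setup.Winning L C φ →
    (D : Setup.ExtController L) →
    ((xs : ℕ → Fin m → 𝔻) → Σ (ℕ → Fin k → 𝔻) (Setup.Produced L C D xs))
    × ((xs : ℕ → Fin m → 𝔻) (ys : ℕ → Fin k → 𝔻) →
    Setup.Produced L C D xs ys → Sat (Setup.TTrace L xs ys) φ 0)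
theorem1 L (L? , ∃fc?) φ C winning D =
  (λ xs → _ , Composition.produced C D (proj₂ ∘ winning) xs) ,
  λ xs ys P → Sat-realised (produced⇒realised P) φ 0 (proj₁ (winning (Produced.ev P)))
  where
  open Abstraction L
  open Partition L? ∃fc?
  open Setup L using (Produced)
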